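{- Let $b\ge 1$ and let $B:\mathbb{Z}_b\to\{0,1\}$ be a 2-coloring. Let $n=bt+r$ with $t\ge 1$ and $1\le r\le b-1$, and let $c:\mathbb{Z}_n\to\{0,1\}$ be any coloring with $c(j)=B(j \bmod b)$ for $0\le j<bt$ (the values $c(j)$ for $bt\le j<n$ arbitrary); that is, $c$ is the bit string $BB\cdots BR$ with $t$ copies of $B$ followed by an arbitrary string $R$ of length $r$. For $r_1,r_2,r_3\ge 0$, an $(r_1,r_2,r_3)$-generalized 4-AP in $\mathbb{Z}_b$ with parameters $(a,d)\in\mathbb{Z}_b^2$ is the sequence $(a,\ a+d-r_1,\ a+2d-(r_1+r_2),\ a+3d-(r_1+r_2+r_3))$ in $\mathbb{Z}_b$. For $0\le i\le 7$, write $i$ in binary as $x_1x_2x_3$ (so $i=4x_1+2x_2+x_3$) and let $c_i$ be the number of pairs $(a,d)\in\mathbb{Z}_b^2$ whose $(x_1r,x_2r,x_3r)$-generalized 4-AP is monochromatic under $B$. Let $(a_0,\dots,a_7)=(\tfrac16,\tfrac1{12},\tfrac16,\tfrac1{12},\tfrac1{12},\tfrac16,\tfrac1{12},\tfrac16)$. Then, with $b$, $B$, $r$ fixed and $t\to\infty$, the number of monochromatic 4-APs in $\mathbb{Z}_n$ under $c$ is \[\sum_{i=0}^7 a_ic_i t^2+O(t).\] In particular, \[m_4(\mathbb{Z}_n)\le \sum_{i=0}^7 a_i\frac{c_i}{b^2}+o(1).\]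
   Context: 4-APs in $\mathbb{Z}_n$ are the sequences $(a,a+d,a+2d,a+3d)$ with $(a,d)\in\mathbb{Z}_n^2$ (degenerate ones included, $n^2$ in total), and a 4-AP is counted as monochromatic according to its parameter pair. $m_4(\mathbb{Z}_n)=\min_c m_4(\mathbb{Z}_n,c)/n^2$, where $m_4(\mathbb{Z}_n,c)$ is the number of monochromatic 4-APs under $c$. -}

module Defs where

open import Data.Nat using (ℕ; zero; suc; _+_; _*_; NonZero)
open import Data.Nat.DivMod using (_mod_)
open import Data.Integer as ℤ using (ℤ; +_)
open import Data.Integer.DivMod using (_%ℕ_)
open import Data.Fin using (Fin; toℕ)
open import Data.Bool using (Bool; true; false; if_then_else_)
open import Data.List using (List; map; allFin)
open import Data.Nat.ListAction using (sum)

same4 : Bool → Bool → Bool → Bool → Bool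
same4 true  true  true  true  = true
same4 false false false false = true
same4 _     _     _     _     = false

countPairs : (n : ℕ) → (Fin n → Fin n → Bool) → ℕ
countPairs n f = sum (map (λ a → sum (map (λ d → if f a d then 1 else 0) (allFin n))) (allFin n))

zmod : (n : ℕ) .{{_ : NonZero n}} → ℤ → Fin n
zmod n i = (i %ℕ n) mod n

mono4 : (n : ℕ) .{{_ : NonZero n}} → (Fin n → Bool) → ℕ
mono4 n c = countPairs n (λ a d →
  same4 (c (zmod n (+ toℕ a)))
        (c (zmod n (+ toℕ a ℤ.+ + toℕ d)))
        (c (zmod n (+ toℕ a ℤ.+ + (2 * toℕ d))))
        (c (zmod n (+ toℕ a ℤ.+ + (3 * toℕ d)))))

genMono4 : (b : ℕ) .{{_ : NonZero b}} → (Fin b → Bool) → ℕ → ℕ → ℕ → ℕ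
genMono4 b B r₁ r₂ r₃ = countPairs b (λ a d →
  same4 (B (zmod b (+ toℕ a)))
        (B (zmod b (+ toℕ a ℤ.+ + toℕ d ℤ.- + r₁)))
        (B (zmod b (+ toℕ a ℤ.+ + (2 * toℕ d) ℤ.- + (r₁ + r₂))))
        (B (zmod b (+ toℕ a ℤ.+ + (3 * toℕ d) ℤ.- + (r₁ + r₂ + r₃)))))

cI : (b : ℕ) .{{_ : NonZero b}} → (Fin b → Bool) → ℕ → ℕ → ℕ → ℕ → ℕ
cI b B r x₁ x₂ x₃ = genMono4 b B (x₁ * r) (x₂ * r) (x₃ * r)

-- 12 · Σ_{i=0}^{7} a_i c_i, with 12·(a_0,…,a_7) = (2,1,2,1,1,2,1,2)
S12 : (b : ℕ) .{{_ : NonZero b}} → (Fin b → Bool) → ℕ → ℕ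
S12 b B r =
    2 * cI b B r 0 0 0 + 1 * cI b B r 0 0 1 + 2 * cI b B r 0 1 0 + 1 * cI b B r 0 1 1
  + 1 * cI b B r 1 0 0 + 2 * cI b B r 1 0 1 + 1 * cI b B r 1 1 0 + 2 * cI b B r 1 1 1

module Submission where

-- Write a = b α + a₀, d = b δ + d₀ with block indices α, δ < t and offsets a₀, d₀ < b.  The k-th
-- term a + k d lies in block α + kδ at offset a₀ + k d₀; reducing mod n moves it back by r for
-- each of its w_k = ⌊(α + kδ)/t⌋ wraps, so unless α + kδ is within 3 of a multiple of t its
-- colour is B(a₀ + k d₀ − w_k r).  The wrap triple (w₁, w₂, w₃) has increments (x₁, x₂, x₃) in
-- {0,1}³, i.e. is one of eight patterns i = 4x₁ + 2x₂ + x₃, and the progression is then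
-- monochromatic iff the (x₁r, x₂r, x₃r)-generalized 4-AP of (a₀, d₀) is.  So the count is
-- Σ_i N_i c_i + O(t), with N_i the grid points (α, δ) ∈ [0, t)² of pattern i; these regions
-- are cut out by the lines α + kδ = m t and 12 N_i = 12 a_i t² + O(t) by summing columns.
--
-- The density bound then takes c = B everywhere.

open import Defs
open import Data.Nat using (ℕ; _+_; _*_; _≤_; _<_; NonZero)
open import Data.Nat.DivMod using (_mod_)
open import Data.Fin using (Fin; toℕ)
open import Data.Bool using (Bool)
open import Data.Product using (Σ; _×_)
open import Relation.Binary.PropositionalEquality using (_≡_)

open import Data.Nat hiding (∣_-_∣)
open import Data.Nat.Properties
open import Data.Nat.DivMod
open import Data.List using (map; allFin; tabulate)
open import Data.List.Properties using (map-tabulate)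
open import Data.Nat.ListAction using (sum)
open import Data.Product using (_,_; proj₁; proj₂)
open import Data.Sum using (inj₁; inj₂)
open import Data.Empty using (⊥-elim)
open import Data.Unit using (tt)
open import Data.Bool using (true; false; if_then_else_; _∧_; not; T)
open import Relation.Binary.PropositionalEquality
open import Relation.Nullary using (yes; no)
open import Data.Nat.Tactic.RingSolver using (solve-∀)
open import Data.Fin.Properties using (toℕ-injective; toℕ-fromℕ<)
import Data.Integer as ℤ
import Data.Integer.Properties as ℤₚ
open import Data.Integer.DivMod using (_%ℕ_; _/ℕ_; a≡a%ℕn+[a/ℕn]*n; n%ℕd<d)
import Data.Integer.Tactic.RingSolver as ℤ-Solver

≤-by : ∀ {a b} c → a + c ≡ b → a ≤ b
≤-by {a} c eq = subst (a ≤_) eq (m≤m+n a c)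

+-interchange : ∀ a b c d → a + b + (c + d) ≡ a + c + (b + d)
+-interchange = solve-∀

module Sums where

  sumTo : ℕ → (ℕ → ℕ) → ℕ
  sumTo zero    f = 0
  sumTo (suc n) f = f 0 + sumTo n (λ i → f (suc i))

  sumTo-cong : ∀ n {f g : ℕ → ℕ} → (∀ i → i < n → f i ≡ g i) → sumTo n f ≡ sumTo n g
  sumTo-cong zero    h = refl
  sumTo-cong (suc n) h = cong₂ _+_ (h 0 z<s) (sumTo-cong n (λ i i<n → h (suc i) (s<s i<n)))

  sumTo-mono : ∀ n {f g : ℕ → ℕ} → (∀ i → i < n → f i ≤ g i) → sumTo n f ≤ sumTo n g
  sumTo-mono zero    h = z≤n
  sumTo-mono (suc n) h = +-mono-≤ (h 0 z<s) (sumTo-mono n (λ i i<n → h (suc i) (s<s i<n)))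

  sumTo-+ : ∀ n (f g : ℕ → ℕ) → sumTo n (λ i → f i + g i) ≡ sumTo n f + sumTo n g
  sumTo-+ zero    f g = refl
  sumTo-+ (suc n) f g = begin
    f 0 + g 0 + sumTo n (λ i → f (suc i) + g (suc i))
      ≡⟨ cong ((f 0 + g 0) +_) (sumTo-+ n (λ i → f (suc i)) (λ i → g (suc i))) ⟩
    f 0 + g 0 + (sumTo n (λ i → f (suc i)) + sumTo n (λ i → g (suc i)))
      ≡⟨ +-interchange (f 0) (g 0) _ _ ⟩
    f 0 + sumTo n (λ i → f (suc i)) + (g 0 + sumTo n (λ i → g (suc i))) ∎
    where open ≡-Reasoning

  sumTo-*ˡ : ∀ n c (f : ℕ → ℕ) → sumTo n (λ i → c * f i) ≡ c * sumTo n f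
  sumTo-*ˡ zero    c f = sym (*-zeroʳ c)
  sumTo-*ˡ (suc n) c f =
    trans (cong (c * f 0 +_) (sumTo-*ˡ n c (λ i → f (suc i)))) (sym (*-distribˡ-+ c (f 0) _))

  sumTo-const : ∀ n c → sumTo n (λ _ → c) ≡ n * c
  sumTo-const zero    c = refl
  sumTo-const (suc n) c = cong (c +_) (sumTo-const n c)

  sumTo-0 : ∀ n → sumTo n (λ _ → 0) ≡ 0
  sumTo-0 n = trans (sumTo-const n 0) (*-zeroʳ n)

  sumTo-split : ∀ m n (f : ℕ → ℕ) → sumTo (m + n) f ≡ sumTo m f + sumTo n (λ i → f (m + i))
  sumTo-split zero    n f = refl
  sumTo-split (suc m) n f =
    trans (cong (f 0 +_) (sumTo-split m n (λ i → f (suc i)))) (sym (+-assoc (f 0) _ _))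

  sumTo-blocks : ∀ b t (f : ℕ → ℕ) →
    sumTo (b * t) f ≡ sumTo t (λ α → sumTo b (λ a₀ → f (b * α + a₀)))
  sumTo-blocks b zero    f = cong (λ m → sumTo m f) (*-zeroʳ b)
  sumTo-blocks b (suc t) f = begin
    sumTo (b * suc t) f
      ≡⟨ cong (λ m → sumTo m f) (*-suc b t) ⟩
    sumTo (b + b * t) f
      ≡⟨ sumTo-split b (b * t) f ⟩
    sumTo b f + sumTo (b * t) (λ i → f (b + i))
      ≡⟨ cong₂ _+_ (sumTo-cong b (λ a₀ _ → cong (λ z → f (z + a₀)) (sym (*-zeroʳ b))))
                   (trans (sumTo-blocks b t (λ i → f (b + i)))
                          (sumTo-cong t (λ α _ → sumTo-cong b (λ a₀ _ → cong f (next-block α a₀))))) ⟩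
    sumTo b (λ a₀ → f (b * 0 + a₀)) + sumTo t (λ α → sumTo b (λ a₀ → f (b * suc α + a₀))) ∎
    where
    open ≡-Reasoning
    next-block : ∀ α a₀ → b + (b * α + a₀) ≡ b * suc α + a₀
    next-block α a₀ = trans (sym (+-assoc b (b * α) a₀)) (cong (_+ a₀) (sym (*-suc b α)))

  sumTo-swap : ∀ m n (f : ℕ → ℕ → ℕ) →
    sumTo m (λ i → sumTo n (λ j → f i j)) ≡ sumTo n (λ j → sumTo m (λ i → f i j))
  sumTo-swap zero    n f = sym (sumTo-0 n)
  sumTo-swap (suc m) n f =
    trans (cong (sumTo n (f 0) +_) (sumTo-swap m n (λ i → f (suc i))))
          (sym (sumTo-+ n (f 0) (λ j → sumTo m (λ i → f (suc i) j))))

  sumTo-bounded : ∀ n c (f : ℕ → ℕ) → (∀ i → f i ≤ c) → sumTo n f ≤ n * c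
  sumTo-bounded n c f h = ≤-trans (sumTo-mono n (λ i _ → h i)) (≤-reflexive (sumTo-const n c))

  sumTo-*ʳ : ∀ n c (f : ℕ → ℕ) → sumTo n (λ i → f i * c) ≡ sumTo n f * c
  sumTo-*ʳ n c f = trans (sumTo-cong n (λ i _ → *-comm (f i) c)) (trans (sumTo-*ˡ n c f) (*-comm c (sumTo n f)))

  sumTo-last : ∀ n (f : ℕ → ℕ) → sumTo (suc n) f ≡ sumTo n f + f n
  sumTo-last zero    f = +-comm (f 0) 0
  sumTo-last (suc n) f = trans (cong (f 0 +_) (sumTo-last n (λ i → f (suc i)))) (sym (+-assoc (f 0) _ _))

  Σ² : ℕ → (ℕ → ℕ → ℕ) → ℕ
  Σ² m F = sumTo m (λ i → sumTo m (λ j → F i j))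

  Σ²-cong : ∀ m {F G : ℕ → ℕ → ℕ} → (∀ i j → i < m → j < m → F i j ≡ G i j) → Σ² m F ≡ Σ² m G
  Σ²-cong m h = sumTo-cong m (λ i i<m → sumTo-cong m (λ j j<m → h i j i<m j<m))

  Σ²-*ʳ : ∀ m c (F : ℕ → ℕ → ℕ) → Σ² m (λ i j → F i j * c) ≡ Σ² m F * c
  Σ²-*ʳ m c F = trans (sumTo-cong m (λ i _ → sumTo-*ʳ m c (F i))) (sumTo-*ʳ m c _)

  Σ²-*ˡ : ∀ m c (F : ℕ → ℕ → ℕ) → Σ² m (λ i j → c * F i j) ≡ c * Σ² m F
  Σ²-*ˡ m c F = trans (sumTo-cong m (λ i _ → sumTo-*ˡ m c (F i))) (sumTo-*ˡ m c _)

  Σ²-const : ∀ m c → Σ² m (λ _ _ → c) ≡ m * (m * c)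
  Σ²-const m c = trans (sumTo-cong m (λ _ _ → sumTo-const m c)) (sumTo-const m (m * c))

  Σ²-blocks : ∀ b t (F : ℕ → ℕ → ℕ) →
    Σ² (b * t) F ≡ Σ² b (λ a₀ d₀ → Σ² t (λ δ α → F (b * α + a₀) (b * δ + d₀)))
  Σ²-blocks b t F = begin
    sumTo (b * t) (λ a → sumTo (b * t) (F a))
      ≡⟨ sumTo-blocks b t _ ⟩
    sumTo t (λ α → sumTo b (λ a₀ → sumTo (b * t) (F (b * α + a₀))))
      ≡⟨ sumTo-cong t (λ α _ → sumTo-cong b (λ a₀ _ → sumTo-blocks b t _)) ⟩
    sumTo t (λ α → sumTo b (λ a₀ → sumTo t (λ δ → sumTo b (λ d₀ → G a₀ d₀ α δ))))
      ≡⟨ sumTo-swap t b _ ⟩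
    sumTo b (λ a₀ → sumTo t (λ α → sumTo t (λ δ → sumTo b (λ d₀ → G a₀ d₀ α δ))))
      ≡⟨ sumTo-cong b (λ a₀ _ → inner a₀) ⟩
    sumTo b (λ a₀ → sumTo b (λ d₀ → sumTo t (λ δ → sumTo t (λ α → G a₀ d₀ α δ)))) ∎
    where
    open ≡-Reasoning
    G : ℕ → ℕ → ℕ → ℕ → ℕ
    G a₀ d₀ α δ = F (b * α + a₀) (b * δ + d₀)
    inner : ∀ a₀ → sumTo t (λ α → sumTo t (λ δ → sumTo b (λ d₀ → G a₀ d₀ α δ)))
                 ≡ sumTo b (λ d₀ → sumTo t (λ δ → sumTo t (λ α → G a₀ d₀ α δ)))
    inner a₀ = trans (sumTo-cong t (λ α _ → sumTo-swap t b _))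
                (trans (sumTo-swap t b _) (sumTo-cong b (λ d₀ _ → sumTo-swap t t _)))

  Σ²-sumTo : ∀ m k (F : ℕ → ℕ → ℕ → ℕ) →
    Σ² m (λ i j → sumTo k (λ x → F x i j)) ≡ sumTo k (λ x → Σ² m (F x))
  Σ²-sumTo m k F = trans (sumTo-cong m (λ i _ → sumTo-swap m k (λ j x → F x i j)))
                         (sumTo-swap m k (λ i x → sumTo m (F x i)))

  ⟦_⟧ : Bool → ℕ
  ⟦ b ⟧ = if b then 1 else 0

  ⟦⟧≤1 : ∀ b → ⟦ b ⟧ ≤ 1
  ⟦⟧≤1 true  = ≤-refl
  ⟦⟧≤1 false = z≤n

  countPairs-sumTo : ∀ n (P : ℕ → ℕ → Bool) →
    countPairs n (λ a d → P (toℕ a) (toℕ d)) ≡ sumTo n (λ a → sumTo n (λ d → ⟦ P a d ⟧))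
  countPairs-sumTo n P =
    trans (sum-allFin n (λ a → sum (map (λ d → ⟦ P a (toℕ d) ⟧) (allFin n))))
          (sumTo-cong n (λ a _ → sum-allFin n (λ d → ⟦ P a d ⟧)))
    where
    sum-tabulate : ∀ n (g : ℕ → ℕ) → sum (tabulate {n = n} (λ i → g (toℕ i))) ≡ sumTo n g
    sum-tabulate zero    g = refl
    sum-tabulate (suc n) g = cong (g 0 +_) (sum-tabulate n (λ i → g (suc i)))
    sum-allFin : ∀ n (g : ℕ → ℕ) → sum (map (λ i → g (toℕ i)) (allFin n)) ≡ sumTo n g
    sum-allFin n g = trans (cong sum (map-tabulate {n = n} (λ i → i) (λ i → g (toℕ i)))) (sum-tabulate n g)

open Sums

module Approx where

  infix 4 _≈[_]_
  _≈[_]_ : ℕ → ℕ → ℕ → Set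
  x ≈[ e ] y = (x ≤ y + e) × (y ≤ x + e)

  ≈-reflexive : ∀ {x y} e → x ≡ y → x ≈[ e ] y
  ≈-reflexive {x} e refl = m≤m+n x e , m≤m+n x e

  ≈-exceeds : ∀ {x y} e → x ≡ y + e → x ≈[ e ] y
  ≈-exceeds {y = y} e refl = ≤-refl , ≤-trans (m≤m+n y e) (m≤m+n (y + e) e)

  ≈-between : ∀ {x y e} → y ≤ x → x ≤ y + e → x ≈[ e ] y
  ≈-between {x} {e = e} y≤x x≤y+e = x≤y+e , ≤-trans y≤x (m≤m+n x e)

  ≈-sym : ∀ {x y e} → x ≈[ e ] y → y ≈[ e ] x
  ≈-sym (p , q) = q , p

  ≈-weaken : ∀ {x y e e′} → e ≤ e′ → x ≈[ e ] y → x ≈[ e′ ] y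
  ≈-weaken {x} {y} e≤e′ (p , q) = ≤-trans p (+-monoʳ-≤ y e≤e′) , ≤-trans q (+-monoʳ-≤ x e≤e′)

  ≈-trans : ∀ {x y z e₁ e₂} → x ≈[ e₁ ] y → y ≈[ e₂ ] z → x ≈[ e₁ + e₂ ] z
  ≈-trans {x} {y} {z} {e₁} {e₂} (p , q) (p′ , q′) =
    ≤-trans p (≤-trans (+-monoˡ-≤ e₁ p′) (≤-reflexive (shuffle z e₂ e₁))) ,
    ≤-trans q′ (≤-trans (+-monoˡ-≤ e₂ q) (≤-reflexive (+-assoc x e₁ e₂)))
    where
    shuffle : ∀ z e₂ e₁ → z + e₂ + e₁ ≡ z + (e₁ + e₂)
    shuffle = solve-∀

  ≈-+ : ∀ {x₁ y₁ x₂ y₂ e₁ e₂} → x₁ ≈[ e₁ ] y₁ → x₂ ≈[ e₂ ] y₂ → x₁ + x₂ ≈[ e₁ + e₂ ] y₁ + y₂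
  ≈-+ {x₁} {y₁} {x₂} {y₂} {e₁} {e₂} (p , q) (p′ , q′) =
    ≤-trans (+-mono-≤ p p′) (≤-reflexive (+-interchange y₁ e₁ y₂ e₂)) ,
    ≤-trans (+-mono-≤ q q′) (≤-reflexive (+-interchange x₁ e₁ x₂ e₂))

  ≈-*ˡ : ∀ {x y e} c → x ≈[ e ] y → c * x ≈[ c * e ] c * y
  ≈-*ˡ {x} {y} {e} c (p , q) =
    ≤-trans (*-monoʳ-≤ c p) (≤-reflexive (*-distribˡ-+ c y e)) ,
    ≤-trans (*-monoʳ-≤ c q) (≤-reflexive (*-distribˡ-+ c x e))

  ≈-cancelʳ : ∀ {x y c e} → x + c ≈[ e ] y + c → x ≈[ e ] y
  ≈-cancelʳ {x} {y} {c} {e} (p , q) =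
    +-cancelʳ-≤ c x (y + e) (≤-trans p (≤-reflexive (shuffle y c e))) ,
    +-cancelʳ-≤ c y (x + e) (≤-trans q (≤-reflexive (shuffle x c e)))
    where
    shuffle : ∀ y c e → y + c + e ≡ y + e + c
    shuffle = solve-∀

  ≈-congˡ : ∀ {x x′ y e} → x ≡ x′ → x ≈[ e ] y → x′ ≈[ e ] y
  ≈-congˡ refl p = p

  ≈-congʳ : ∀ {x y y′ e} → y ≡ y′ → x ≈[ e ] y → x ≈[ e ] y′
  ≈-congʳ refl p = p

  ≈-telescope : ∀ T (g a b : ℕ → ℕ) c → (∀ δ → g (suc δ) + a δ ≈[ c ] g δ + b δ) →
                g T + sumTo T a ≈[ T * c ] g 0 + sumTo T b
  ≈-telescope zero    g a b c step = ≈-reflexive 0 refl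
  ≈-telescope (suc T) g a b c step =
    ≈-congˡ (swap (g (suc T)) (sumTo T a′) (a 0))
      (≈-congʳ (+-assoc (g 0) (b 0) (sumTo T b′))
        (≈-weaken (≤-reflexive (errors T c))
          (≈-trans (≈-+ (≈-telescope T (λ δ → g (suc δ)) a′ b′ c (λ δ → step (suc δ))) (≈-reflexive 0 refl))
                   (≈-congˡ (right-comm (g 1) (a 0) (sumTo T b′)) (≈-+ (step 0) (≈-reflexive 0 refl))))))
    where
    a′ b′ : ℕ → ℕ
    a′ δ = a (suc δ)
    b′ δ = b (suc δ)
    swap : ∀ x y z → x + y + z ≡ x + (z + y)
    swap = solve-∀
    right-comm : ∀ x y z → x + y + z ≡ x + z + y
    right-comm = solve-∀
    errors : ∀ T c → T * c + 0 + (c + 0) ≡ c + T * c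
    errors = solve-∀

  ≈-sumTo : ∀ n {f g e : ℕ → ℕ} → (∀ i → i < n → f i ≈[ e i ] g i) → sumTo n f ≈[ sumTo n e ] sumTo n g
  ≈-sumTo zero    h = ≈-reflexive 0 refl
  ≈-sumTo (suc n) h = ≈-+ (h 0 z<s) (≈-sumTo n (λ i i<n → h (suc i) (s<s i<n)))

  ≈-Σ² : ∀ m {F G E : ℕ → ℕ → ℕ} → (∀ i j → i < m → j < m → F i j ≈[ E i j ] G i j) → Σ² m F ≈[ Σ² m E ] Σ² m G
  ≈-Σ² m h = ≈-sumTo m (λ i i<m → ≈-sumTo m (λ j j<m → h i j i<m j<m))

  ≈-indicators : ∀ {x y e} → x ≤ 1 → y ≤ 1 → 1 ≤ e → x ≈[ e ] y
  ≈-indicators {x} {y} {e} x≤1 y≤1 1≤e = ≤-trans x≤1 (≤-trans 1≤e (m≤n+m e y)) , ≤-trans y≤1 (≤-trans 1≤e (m≤n+m e x))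

  Σ²-border : ∀ m r (F : ℕ → ℕ → ℕ) → (∀ i j → F i j ≤ 1) → Σ² (m + r) F ≈[ m * r + r * (m + r) ] Σ² m F
  Σ²-border m r F F≤1 =
    ≈-between (≤-trans (m≤m+n (Σ² m F) _) (≤-reflexive (sym decompose)))
              (≤-trans (≤-reflexive decompose) (+-monoʳ-≤ (Σ² m F) (+-mono-≤ columns rows)))
    where
    open ≡-Reasoning
    G : ℕ → ℕ
    G i = sumTo (m + r) (F i)
    decompose : Σ² (m + r) F ≡ Σ² m F + (sumTo m (λ i → sumTo r (λ j → F i (m + j))) + sumTo r (λ i → G (m + i)))
    decompose = begin
      sumTo (m + r) G
        ≡⟨ sumTo-split m r G ⟩
      sumTo m G + sumTo r (λ i → G (m + i))
        ≡⟨ cong (_+ sumTo r (λ i → G (m + i))) (trans (sumTo-cong m (λ i _ → sumTo-split m r (F i))) (sumTo-+ m _ _)) ⟩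
      Σ² m F + sumTo m (λ i → sumTo r (λ j → F i (m + j))) + sumTo r (λ i → G (m + i))
        ≡⟨ +-assoc (Σ² m F) _ _ ⟩
      Σ² m F + (sumTo m (λ i → sumTo r (λ j → F i (m + j))) + sumTo r (λ i → G (m + i))) ∎
    columns : sumTo m (λ i → sumTo r (λ j → F i (m + j))) ≤ m * r
    columns = ≤-trans (sumTo-mono m (λ i _ → ≤-trans (sumTo-bounded r 1 _ (λ j → F≤1 i (m + j))) (≤-reflexive (*-identityʳ r))))
                      (≤-reflexive (sumTo-const m r))
    rows : sumTo r (λ i → G (m + i)) ≤ r * (m + r)
    rows = sumTo-bounded r (m + r) _ (λ i → ≤-trans (sumTo-bounded (m + r) 1 _ (λ j → F≤1 (m + i) j)) (≤-reflexive (*-identityʳ (m + r))))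

open Approx

-- Sums of the truncated linear functions M − kδ and kδ − M, which grow like squares.
module Squares where

  sq : ℕ → ℕ
  sq x = x * x

  sq-step-down : ∀ k y → sq (y ∸ k) + 2 * k * y ≈[ k * k ] sq y + 0
  sq-step-down k y with k ≤? y
  ... | yes k≤y = subst (λ y → sq (y ∸ k) + 2 * k * y ≈[ k * k ] sq y + 0) (m∸n+n≡m k≤y) (above (y ∸ k))
    where
    expand : ∀ z k → z * z + 2 * k * (z + k) ≡ (z + k) * (z + k) + 0 + k * k
    expand = solve-∀
    above : ∀ z → sq (z + k ∸ k) + 2 * k * (z + k) ≈[ k * k ] sq (z + k) + 0
    above z rewrite m+n∸n≡m z k = ≈-exceeds (k * k) (expand z k)
  ... | no k≰y = subst (λ k → sq (y ∸ k) + 2 * k * y ≈[ k * k ] sq y + 0) (m∸n+n≡m (<⇒≤ (≰⇒> k≰y))) (below (k ∸ y))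
    where
    lower : ∀ h y → y * y + 0 + (y * y + 2 * h * y) ≡ 0 + 2 * (h + y) * y
    lower = solve-∀
    upper : ∀ h y → 0 + 2 * (h + y) * y + h * h ≡ y * y + 0 + (h + y) * (h + y)
    upper = solve-∀
    below : ∀ h → sq (y ∸ (h + y)) + 2 * (h + y) * y ≈[ (h + y) * (h + y) ] sq y + 0
    below h rewrite m≤n⇒m∸n≡0 (m≤n+m y h) = ≈-between (≤-by _ (lower h y)) (≤-by (h * h) (upper h y))

  sq-step-up : ∀ k M x → sq ((k + x) ∸ M) + 0 ≈[ k * k ] sq (x ∸ M) + 2 * k * (x ∸ M)
  sq-step-up k M x with M ≤? x
  ... | yes M≤x = subst (λ x → sq ((k + x) ∸ M) + 0 ≈[ k * k ] sq (x ∸ M) + 2 * k * (x ∸ M)) (m∸n+n≡m M≤x) (above (x ∸ M))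
    where
    expand : ∀ z k → (k + z) * (k + z) + 0 ≡ z * z + 2 * k * z + k * k
    expand = solve-∀
    above : ∀ z → sq ((k + (z + M)) ∸ M) + 0 ≈[ k * k ] sq (z + M ∸ M) + 2 * k * (z + M ∸ M)
    above z rewrite sym (+-assoc k z M) | m+n∸n≡m (k + z) M | m+n∸n≡m z M = ≈-exceeds (k * k) (expand z k)
  ... | no M≰x rewrite m≤n⇒m∸n≡0 (<⇒≤ (≰⇒> M≰x)) | *-zeroʳ (2 * k) =
    ≈-between z≤n (≤-trans (≤-reflexive (+-identityʳ _)) (*-mono-≤ overshoot overshoot))
    where
    overshoot : (k + x) ∸ M ≤ k
    overshoot = m≤n+o⇒m∸n≤o (k + x) M (≤-trans (+-monoʳ-≤ k (<⇒≤ (≰⇒> M≰x))) (≤-reflexive (+-comm k M)))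

  -- P k M T = Σ_{δ<T} (M ∸ kδ) counts the lattice points α + kδ < M with δ < T; it is about M²/2k.
  P : ℕ → ℕ → ℕ → ℕ
  P k M T = sumTo T (λ δ → M ∸ k * δ)

  P-approx : ∀ k M T → 2 * k * P k M T + sq (M ∸ k * T) ≈[ T * (k * k) ] sq M
  P-approx k M T =
    ≈-congˡ (trans (+-comm (sq (M ∸ k * T)) _) (cong (_+ sq (M ∸ k * T)) (sumTo-*ˡ T (2 * k) (λ δ → M ∸ k * δ))))
      (≈-congʳ (cong₂ _+_ (cong (λ z → sq (M ∸ z)) (*-zeroʳ k)) (sumTo-0 T) ∙ +-identityʳ (sq M))
        (≈-telescope T (λ δ → sq (M ∸ k * δ)) (λ δ → 2 * k * (M ∸ k * δ)) (λ _ → 0) (k * k) step))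
    where
    _∙_ = trans
    next : ∀ δ → M ∸ k * suc δ ≡ (M ∸ k * δ) ∸ k
    next δ = cong (M ∸_) (*-suc k δ ∙ +-comm k (k * δ)) ∙ sym (∸-+-assoc M (k * δ) k)
    step : ∀ δ → sq (M ∸ k * suc δ) + 2 * k * (M ∸ k * δ) ≈[ k * k ] sq (M ∸ k * δ) + 0
    step δ rewrite next δ = sq-step-down k (M ∸ k * δ)

  Q : ℕ → ℕ → ℕ → ℕ
  Q k M T = sumTo T (λ δ → k * δ ∸ M)

  Q-approx : ∀ k M T → 2 * k * Q k M T ≈[ T * (k * k) ] sq (k * T ∸ M)
  Q-approx k M T =
    ≈-sym (≈-congˡ (cong (sq (k * T ∸ M) +_) (sumTo-0 T) ∙ +-identityʳ _)
      (≈-congʳ (cong₂ _+_ start (sumTo-*ˡ T (2 * k) (λ δ → k * δ ∸ M)))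
        (≈-telescope T (λ δ → sq (k * δ ∸ M)) (λ _ → 0) (λ δ → 2 * k * (k * δ ∸ M)) (k * k) step)))
    where
    _∙_ = trans
    start : sq (k * 0 ∸ M) ≡ 0
    start rewrite *-zeroʳ k | 0∸n≡0 M = refl
    step : ∀ δ → sq (k * suc δ ∸ M) + 0 ≈[ k * k ] sq (k * δ ∸ M) + 2 * k * (k * δ ∸ M)
    step δ rewrite *-suc k δ = sq-step-up k M (k * δ)

open Squares

module Columns where

  ⊓-split : ∀ x t → x ⊓ t + (x ∸ t) ≡ x
  ⊓-split x t = trans (cong (_+ (x ∸ t)) (⊓-comm x t)) (m⊓n+n∸m≡n t x)

  ∸-split : ∀ a b c → a ∸ (b ∸ c) + (c ∸ b) ≡ (a + c) ∸ b
  ∸-split a b c with c ≤? b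
  ... | yes c≤b = begin
    a ∸ (b ∸ c) + (c ∸ b)   ≡⟨ cong (a ∸ (b ∸ c) +_) (m≤n⇒m∸n≡0 c≤b) ⟩
    a ∸ (b ∸ c) + 0         ≡⟨ +-identityʳ _ ⟩
    a ∸ (b ∸ c)             ≡⟨ sym ([m+n]∸[m+o]≡n∸o c a (b ∸ c)) ⟩
    (c + a) ∸ (c + (b ∸ c)) ≡⟨ cong₂ _∸_ (+-comm c a) (m+[n∸m]≡n c≤b) ⟩
    (a + c) ∸ b             ∎
    where open ≡-Reasoning
  ... | no c≰b = begin
    a ∸ (b ∸ c) + (c ∸ b) ≡⟨ cong (λ z → a ∸ z + (c ∸ b)) (m≤n⇒m∸n≡0 (<⇒≤ (≰⇒> c≰b))) ⟩
    a + (c ∸ b)           ≡⟨ sym (+-∸-assoc a (<⇒≤ (≰⇒> c≰b))) ⟩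
    (a + c) ∸ b           ∎
    where open ≡-Reasoning

  +-∸-∸-cancel : ∀ t Y y → (t + Y) ∸ y ∸ t ≡ Y ∸ y
  +-∸-∸-cancel t Y y = trans (∸-+-assoc (t + Y) y t) (trans (cong ((t + Y) ∸_) (+-comm y t)) ([m+n]∸[m+o]≡n∸o t Y y))

  -- The two wedges between the lines α = t − δ and α = 2t − 3δ, column by column
  -- (δ ≤ t): they exchange the overshoots 3δ − 2t and t − 3δ for 2δ − t and t − 2δ.
  wedge-above : ∀ t δ → δ ≤ t → ((1 * t ∸ 1 * δ) ⊓ t) ∸ (2 * t ∸ 3 * δ) + (3 * δ ∸ 2 * t) ≡ 2 * δ ∸ 1 * t
  wedge-above t δ δ≤t = begin
    ((1 * t ∸ 1 * δ) ⊓ t) ∸ (2 * t ∸ 3 * δ) + (3 * δ ∸ 2 * t)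
      ≡⟨ cong (λ z → z ∸ (2 * t ∸ 3 * δ) + (3 * δ ∸ 2 * t)) (trans (cong (_⊓ t) t∸δ) (m≤n⇒m⊓n≡m (m∸n≤m t δ))) ⟩
    (t ∸ δ) ∸ (2 * t ∸ 3 * δ) + (3 * δ ∸ 2 * t)
      ≡⟨ ∸-split (t ∸ δ) (2 * t) (3 * δ) ⟩
    ((t ∸ δ) + (δ + 2 * δ)) ∸ (t + 1 * t)
      ≡⟨ cong (_∸ (t + 1 * t)) (trans (sym (+-assoc (t ∸ δ) δ (2 * δ))) (cong (_+ 2 * δ) (m∸n+n≡m δ≤t))) ⟩
    (t + 2 * δ) ∸ (t + 1 * t)
      ≡⟨ [m+n]∸[m+o]≡n∸o t (2 * δ) (1 * t) ⟩
    2 * δ ∸ 1 * t ∎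
    where
    open ≡-Reasoning
    t∸δ : 1 * t ∸ 1 * δ ≡ t ∸ δ
    t∸δ = cong₂ _∸_ (*-identityˡ t) (*-identityˡ δ)

  wedge-below : ∀ t δ → δ ≤ t → ((2 * t ∸ 3 * δ) ⊓ t) ∸ (1 * t ∸ 1 * δ) + (1 * t ∸ 3 * δ) ≡ 1 * t ∸ 2 * δ
  wedge-below t δ δ≤t = begin
    ((2 * t ∸ 3 * δ) ⊓ t) ∸ (1 * t ∸ 1 * δ) + (1 * t ∸ 3 * δ)
      ≡⟨ cong₂ (λ y z → ((2 * t ∸ 3 * δ) ⊓ t) ∸ y + z) (cong₂ _∸_ 1t (*-identityˡ δ)) (cong (_∸ 3 * δ) 1t) ⟩
    ((2 * t ∸ 3 * δ) ⊓ t) ∸ (t ∸ δ) + (t ∸ 3 * δ)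
      ≡⟨ cong (_+ (t ∸ 3 * δ)) (∸-distribʳ-⊓ (t ∸ δ) (2 * t ∸ 3 * δ) t) ⟩
    ((2 * t ∸ 3 * δ) ∸ (t ∸ δ)) ⊓ (t ∸ (t ∸ δ)) + (t ∸ 3 * δ)
      ≡⟨ cong₂ (λ x y → x ⊓ y + (t ∸ 3 * δ)) shifted (m∸[m∸n]≡n δ≤t) ⟩
    (t ∸ 2 * δ) ⊓ δ + (t ∸ 3 * δ)
      ≡⟨ cong ((t ∸ 2 * δ) ⊓ δ +_) (trans (cong (t ∸_) (+-comm δ (2 * δ))) (sym (∸-+-assoc t (2 * δ) δ))) ⟩
    (t ∸ 2 * δ) ⊓ δ + (t ∸ 2 * δ ∸ δ)
      ≡⟨ ⊓-split (t ∸ 2 * δ) δ ⟩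
    t ∸ 2 * δ
      ≡⟨ cong (_∸ 2 * δ) (sym 1t) ⟩
    1 * t ∸ 2 * δ ∎
    where
    open ≡-Reasoning
    1t : 1 * t ≡ t
    1t = *-identityˡ t
    shifted : (2 * t ∸ 3 * δ) ∸ (t ∸ δ) ≡ t ∸ 2 * δ
    shifted = begin
      (2 * t ∸ 3 * δ) ∸ (t ∸ δ)   ≡⟨ ∸-+-assoc (2 * t) (3 * δ) (t ∸ δ) ⟩
      2 * t ∸ (3 * δ + (t ∸ δ))   ≡⟨ cong (2 * t ∸_) (trans (cong (_+ (t ∸ δ)) (+-comm δ (2 * δ))) (trans (+-assoc (2 * δ) δ (t ∸ δ)) (cong (2 * δ +_) (m+[n∸m]≡n δ≤t)))) ⟩
      2 * t ∸ (2 * δ + t)         ≡⟨ cong₂ _∸_ (cong (t +_) 1t) (+-comm (2 * δ) t) ⟩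
      (t + t) ∸ (t + 2 * δ)       ≡⟨ [m+n]∸[m+o]≡n∸o t t (2 * δ) ⟩
      t ∸ 2 * δ                   ∎

  shift-<ᵇ : ∀ α c X → (α + c <ᵇ X) ≡ (α <ᵇ X ∸ c)
  shift-<ᵇ α zero    X       = cong (_<ᵇ X) (+-identityʳ α)
  shift-<ᵇ α (suc c) zero    = refl
  shift-<ᵇ α (suc c) (suc X) = trans (cong (_<ᵇ suc X) (+-suc α c)) (shift-<ᵇ α c X)

  count-below : ∀ T X → sumTo T (λ α → ⟦ α <ᵇ X ⟧) ≡ X ⊓ T
  count-below zero    zero    = refl
  count-below zero    (suc X) = refl
  count-below (suc T) zero    = sumTo-0 T
  count-below (suc T) (suc X) = cong suc (count-below T X)

  count-between : ∀ T X Y → sumTo T (λ α → ⟦ (α <ᵇ X) ∧ not (α <ᵇ Y) ⟧) ≡ (X ⊓ T) ∸ Y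
  count-between T       X       zero    = trans (sumTo-cong T (λ α _ → cong ⟦_⟧ (∧-true (α <ᵇ X)))) (count-below T X)
    where
    ∧-true : ∀ b → b ∧ true ≡ b
    ∧-true true  = refl
    ∧-true false = refl
  count-between zero    zero    (suc Y) = refl
  count-between zero    (suc X) (suc Y) = refl
  count-between (suc T) zero    (suc Y) = sumTo-0 T
  count-between (suc T) (suc X) (suc Y) = count-between T X Y

open Columns

module Residues where
  open ℤ using (ℤ; +_; -[1+_])

  mod-cong : ∀ {x y} b .{{_ : NonZero b}} → x % b ≡ y % b → x mod b ≡ y mod b
  mod-cong {x} {y} b eq = toℕ-injective (trans (toℕ-fromℕ< (m%n<n x b)) (trans eq (sym (toℕ-fromℕ< (m%n<n y b)))))

  toℕ-zmod : ∀ n .{{_ : NonZero n}} p → toℕ (zmod n (+ p)) ≡ p % n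
  toℕ-zmod n p = trans (toℕ-fromℕ< (m%n<n (p % n) n)) (m%n%n≡m%n p n)

  remainder-unique : ∀ b .{{_ : NonZero b}} N ρ (q : ℤ) → ρ < b → + N ≡ + ρ ℤ.+ q ℤ.* + b → N % b ≡ ρ
  remainder-unique b N ρ (+ q) ρ<b eq =
    trans (cong (_% b) (ℤₚ.+-injective (trans eq (trans (cong (ℤ._+_ (+ ρ)) (sym (ℤₚ.pos-* q b))) (sym (ℤₚ.pos-+ ρ (q * b)))))))
          (trans ([m+kn]%n≡m%n ρ q b) (m<n⇒m%n≡m ρ<b))
  remainder-unique b N ρ -[1+ q ] ρ<b eq =
    ⊥-elim (non-negative (trans eq (trans (cong (ℤ._+_ (+ ρ)) negate) (trans (ℤₚ.m-n≡m⊖n ρ X) (ℤₚ.⊖-< ρ<X)))))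
    where
    X = suc q * b
    ρ<X : ρ < X
    ρ<X = <-≤-trans ρ<b (m≤m+n b (q * b))
    negate : -[1+ q ] ℤ.* + b ≡ ℤ.- + X
    negate = trans (sym (ℤₚ.neg-distribˡ-* (+ suc q) (+ b))) (cong ℤ.-_ (sym (ℤₚ.pos-* (suc q) b)))
    non-negative : + N ≢ ℤ.- + (X ∸ ρ)
    non-negative with X ∸ ρ | m<n⇒0<n∸m ρ<X
    ... | suc _ | _ = λ ()

  mod-from-ℤ : ∀ b .{{_ : NonZero b}} N s (z : ℤ) → + N ≡ z ℤ.+ + (b * s) → N mod b ≡ zmod b z
  mod-from-ℤ b N s z eq =
    mod-cong b (trans (remainder-unique b N (z %ℕ b) (z /ℕ b ℤ.+ + s) (n%ℕd<d z b) decomposition)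
                      (sym (m<n⇒m%n≡m (n%ℕd<d z b))))
    where
    regroup : ∀ (ρ q b s : ℤ) → ρ ℤ.+ q ℤ.* b ℤ.+ b ℤ.* s ≡ ρ ℤ.+ (q ℤ.+ s) ℤ.* b
    regroup = ℤ-Solver.solve-∀
    decomposition : + N ≡ + (z %ℕ b) ℤ.+ (z /ℕ b ℤ.+ + s) ℤ.* + b
    decomposition = begin
      + N                                             ≡⟨ eq ⟩
      z ℤ.+ + (b * s)                                 ≡⟨ cong₂ ℤ._+_ (a≡a%ℕn+[a/ℕn]*n z b) (ℤₚ.pos-* b s) ⟩
      + (z %ℕ b) ℤ.+ z /ℕ b ℤ.* + b ℤ.+ + b ℤ.* + s   ≡⟨ regroup (+ (z %ℕ b)) (z /ℕ b) (+ b) (+ s) ⟩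
      + (z %ℕ b) ℤ.+ (z /ℕ b ℤ.+ + s) ℤ.* + b         ∎
      where open ≡-Reasoning

  %-absorb : ∀ m k d .{{_ : NonZero d}} → ((m % d) + k) % d ≡ (m + k) % d
  %-absorb m k d = trans (%-distribˡ-+ (m % d) k d)
    (trans (cong (λ z → (z + k % d) % d) (m%n%n≡m%n m d)) (sym (%-distribˡ-+ m k d)))

  -- Adding c modulo t permutes the residues [0, t).
  sumTo-rotate : ∀ t .{{_ : NonZero t}} c (f : ℕ → ℕ) → sumTo t (λ α → f ((α + c) % t)) ≡ sumTo t f
  sumTo-rotate t zero    f = sumTo-cong t (λ α α<t → cong f (trans (cong (_% t) (+-identityʳ α)) (m<n⇒m%n≡m α<t)))
  sumTo-rotate t (suc c) f = begin
    sumTo t (λ α → f ((α + suc c) % t))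
      ≡⟨ sumTo-cong t (λ α _ → cong f (trans (cong (_% t) (+-suc α c)) (sym (%-absorb (suc α) c t)))) ⟩
    sumTo t (λ α → g (suc α % t))     ≡⟨ rotate-by-one t ⟩
    sumTo t g                          ≡⟨ sumTo-rotate t c f ⟩
    sumTo t f                          ∎
    where
    open ≡-Reasoning
    g : ℕ → ℕ
    g x = f ((x + c) % t)
    rotate-by-one : ∀ t .{{_ : NonZero t}} → sumTo t (λ α → g (suc α % t)) ≡ sumTo t g
    rotate-by-one (suc t′) = begin
      sumTo (suc t′) (λ α → g (suc α % suc t′))
        ≡⟨ sumTo-last t′ _ ⟩
      sumTo t′ (λ α → g (suc α % suc t′)) + g (suc t′ % suc t′)
        ≡⟨ cong₂ _+_ (sumTo-cong t′ (λ α α<t′ → cong g (m<n⇒m%n≡m (s<s α<t′)))) (cong g (n%n≡0 (suc t′))) ⟩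
      sumTo t′ (λ α → g (suc α)) + g 0
        ≡⟨ +-comm _ (g 0) ⟩
      sumTo (suc t′) g ∎

open Residues

Bool-ext : ∀ {a b : Bool} → (T a → T b) → (T b → T a) → a ≡ b
Bool-ext {false} {false} _ _ = refl
Bool-ext {false} {true}  _ g = ⊥-elim (g tt)
Bool-ext {true}  {false} f _ = ⊥-elim (f tt)
Bool-ext {true}  {true}  _ _ = refl

bit₁ bit₂ bit₃ : ℕ → ℕ
bit₁ i = i / 4
bit₂ i = i / 2 % 2
bit₃ i = i % 2

-- 12 a_i: a_i is 1/6 if x₁ = x₃ and 1/12 otherwise.
weight : ℕ → ℕ
weight i = if bit₁ i ≡ᵇ bit₃ i then 2 else 1

-- The grid [0, t)² of block indices (α, δ).  The k-th term α + kδ of the progression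
-- through the blocks has wrapped (α + kδ) / t times around a stretch of t blocks.
module Grid (t : ℕ) .{{_ : NonZero t}} where

  wraps : ℕ → ℕ → ℕ → ℕ
  wraps k α δ = (α + k * δ) / t

  below-next-wrap : ∀ x → x < suc (x / t) * t
  below-next-wrap x = begin-strict
    x                     ≡⟨ m≡m%n+[m/n]*n x t ⟩
    x % t + x / t * t     <⟨ +-monoˡ-< (x / t * t) (m%n<n x t) ⟩
    t + x / t * t         ∎
    where open ≤-Reasoning

  wraps<ᵇ : ∀ x m → (x / t <ᵇ m) ≡ (x <ᵇ m * t)
  wraps<ᵇ x m = Bool-ext (λ h → <⇒<ᵇ (<-≤-trans (below-next-wrap x) (*-monoˡ-≤ t (<ᵇ⇒< (x / t) m h))))
                         (λ h → <⇒<ᵇ (m<n*o⇒m/o<n {n = m} (<ᵇ⇒< x (m * t) h)))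

  -- Along the progression the wrap count grows by 0 or 1 per step.
  data Step : ℕ → ℕ → Set where
    stay : ∀ {w} → Step w w
    up   : ∀ {w} → Step w (suc w)

  step : ∀ {w w′} → w ≤ w′ → w′ ≤ suc w → Step w w′
  step w≤w′ w′≤1+w with m≤n⇒m<n∨m≡n w≤w′
  ... | inj₂ refl = stay
  ... | inj₁ w<w′ rewrite ≤-antisym w′≤1+w w<w′ = up

  wraps-step : ∀ k α δ → δ < t → Step (wraps k α δ) (wraps (suc k) α δ)
  wraps-step k α δ δ<t =
    subst (λ y → Step (x / t) (y / t)) (sym next-term) (step (/-monoˡ-≤ t (m≤m+n x δ)) (s≤s⁻¹ (m<n*o⇒m/o<n x+δ<)))
    where
    x = α + k * δ
    next-term : α + suc k * δ ≡ α + k * δ + δ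
    next-term = trans (cong (α +_) (+-comm δ (k * δ))) (sym (+-assoc α (k * δ) δ))
    x+δ< : x + δ < suc (suc (x / t)) * t
    x+δ< = <-≤-trans (+-mono-<-≤ (below-next-wrap x) (<⇒≤ δ<t)) (≤-reflexive (+-comm (suc (x / t) * t) t))

  wraps-start : ∀ α δ → α < t → wraps 0 α δ ≡ 0
  wraps-start α δ α<t = trans (cong (_/ t) (+-identityʳ α)) (m<n⇒m/n≡0 α<t)

  at-every-point : (P : ℕ → ℕ → ℕ → Set) →
    P 0 0 0 → P 0 0 1 → P 0 1 1 → P 0 1 2 → P 1 1 1 → P 1 1 2 → P 1 2 2 → P 1 2 3 →
    ∀ α δ → α < t → δ < t → P (wraps 1 α δ) (wraps 2 α δ) (wraps 3 α δ)
  at-every-point P p₀ p₁ p₂ p₃ p₄ p₅ p₆ p₇ α δ α<t δ<t =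
    by-steps (subst (λ w → Step w (wraps 1 α δ)) (wraps-start α δ α<t) (wraps-step 0 α δ δ<t))
             (wraps-step 1 α δ δ<t) (wraps-step 2 α δ δ<t)
    where
    by-steps : ∀ {w₁ w₂ w₃} → Step 0 w₁ → Step w₁ w₂ → Step w₂ w₃ → P w₁ w₂ w₃
    by-steps stay stay stay = p₀
    by-steps stay stay up   = p₁
    by-steps stay up   stay = p₂
    by-steps stay up   up   = p₃
    by-steps up   stay stay = p₄
    by-steps up   stay up   = p₅
    by-steps up   up   stay = p₆
    by-steps up   up   up   = p₇

  #[_] : (ℕ → ℕ → ℕ → ℕ) → ℕ
  #[ F ] = Σ² t (λ δ α → F (wraps 1 α δ) (wraps 2 α δ) (wraps 3 α δ))

  #-by-patterns : ∀ F G →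
    F 0 0 0 ≡ G 0 0 0 → F 0 0 1 ≡ G 0 0 1 → F 0 1 1 ≡ G 0 1 1 → F 0 1 2 ≡ G 0 1 2 →
    F 1 1 1 ≡ G 1 1 1 → F 1 1 2 ≡ G 1 1 2 → F 1 2 2 ≡ G 1 2 2 → F 1 2 3 ≡ G 1 2 3 → #[ F ] ≡ #[ G ]
  #-by-patterns F G e₀ e₁ e₂ e₃ e₄ e₅ e₆ e₇ =
    Σ²-cong t (λ δ α δ<t α<t → at-every-point (λ w₁ w₂ w₃ → F w₁ w₂ w₃ ≡ G w₁ w₂ w₃) e₀ e₁ e₂ e₃ e₄ e₅ e₆ e₇ α δ α<t δ<t)

  region : ℕ → ℕ → ℕ → ℕ → Bool
  region i w₁ w₂ w₃ = (w₁ ≡ᵇ bit₁ i) ∧ (w₂ ≡ᵇ bit₁ i + bit₂ i) ∧ (w₃ ≡ᵇ bit₁ i + bit₂ i + bit₃ i)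

  N : ℕ → ℕ
  N i = #[ (λ w₁ w₂ w₃ → ⟦ region i w₁ w₂ w₃ ⟧) ]

  in-first : ℕ → ℕ → ℕ → ℕ → ℕ
  in-first j w₁ w₂ w₃ = sumTo j (λ i → ⟦ region i w₁ w₂ w₃ ⟧)

  N-cumulative : ∀ j → sumTo j N ≡ #[ in-first j ]
  N-cumulative j = sym (Σ²-sumTo t j (λ i δ α → ⟦ region i (wraps 1 α δ) (wraps 2 α δ) (wraps 3 α δ) ⟧))

  below : ℕ → ℕ → ℕ
  below k m = Σ² t (λ δ α → ⟦ wraps k α δ <ᵇ m ⟧)

  threshold : ∀ k m α δ → (wraps k α δ <ᵇ m) ≡ (α <ᵇ m * t ∸ k * δ)
  threshold k m α δ = trans (wraps<ᵇ (α + k * δ) m) (shift-<ᵇ α (k * δ) (m * t))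

  column-below : ∀ k m δ → sumTo t (λ α → ⟦ wraps k α δ <ᵇ m ⟧) ≡ (m * t ∸ k * δ) ⊓ t
  column-below k m δ = trans (sumTo-cong t (λ α _ → cong ⟦_⟧ (threshold k m α δ))) (count-below t _)

  column-between : ∀ k m k′ m′ δ →
    sumTo t (λ α → ⟦ (wraps k α δ <ᵇ m) ∧ not (wraps k′ α δ <ᵇ m′) ⟧) ≡ ((m * t ∸ k * δ) ⊓ t) ∸ (m′ * t ∸ k′ * δ)
  column-between k m k′ m′ δ =
    trans (sumTo-cong t (λ α _ → cong₂ (λ x y → ⟦ x ∧ not y ⟧) (threshold k m α δ) (threshold k′ m′ α δ)))
          (count-between t (m * t ∸ k * δ) (m′ * t ∸ k′ * δ))

  below-next : ∀ k m → below k (suc m) + P k (m * t) t ≡ P k (suc m * t) t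
  below-next k m = trans (sym (sumTo-+ t _ _)) (sumTo-cong t (λ δ _ →
    trans (cong (_+ (m * t ∸ k * δ)) (column-below k (suc m) δ))
          (trans (cong (((t + m * t) ∸ k * δ) ⊓ t +_) (sym (+-∸-∸-cancel t (m * t) (k * δ))))
                 (⊓-split ((t + m * t) ∸ k * δ) t))))

  below-first : ∀ k → below k 1 ≡ P k (1 * t) t
  below-first k = trans (sym (+-identityʳ (below k 1)))
    (trans (cong (below k 1 +_) (sym (sumTo-0-like))) (below-next k 0))
    where
    sumTo-0-like : P k (0 * t) t ≡ 0
    sumTo-0-like = trans (sumTo-cong t (λ δ _ → 0∸n≡0 (k * δ))) (sumTo-0 t)

  -- The regions 3 = (0,1,2) and 4 = (1,1,1) are wedges between two lines.
  N₃-wedge : N 3 + Q 3 (2 * t) t ≡ Q 2 (1 * t) t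
  N₃-wedge = trans (cong (_+ Q 3 (2 * t) t) N₃-between) (trans (sym (sumTo-+ t _ _)) (sumTo-cong t (λ δ δ<t →
    trans (cong (_+ (3 * δ ∸ 2 * t)) (column-between 1 1 3 2 δ)) (wedge-above t δ (<⇒≤ δ<t)))))
    where
    N₃-between : N 3 ≡ #[ (λ w₁ w₂ w₃ → ⟦ (w₁ <ᵇ 1) ∧ not (w₃ <ᵇ 2) ⟧) ]
    N₃-between = #-by-patterns (λ w₁ w₂ w₃ → ⟦ region 3 w₁ w₂ w₃ ⟧) (λ w₁ w₂ w₃ → ⟦ (w₁ <ᵇ 1) ∧ not (w₃ <ᵇ 2) ⟧) refl refl refl refl refl refl refl refl

  N₄-wedge : N 4 + P 3 (1 * t) t ≡ P 2 (1 * t) t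
  N₄-wedge = trans (cong (_+ P 3 (1 * t) t) N₄-between) (trans (sym (sumTo-+ t _ _)) (sumTo-cong t (λ δ δ<t →
    trans (cong (_+ (1 * t ∸ 3 * δ)) (column-between 3 2 1 1 δ)) (wedge-below t δ (<⇒≤ δ<t)))))
    where
    N₄-between : N 4 ≡ #[ (λ w₁ w₂ w₃ → ⟦ (w₃ <ᵇ 2) ∧ not (w₁ <ᵇ 1) ⟧) ]
    N₄-between = #-by-patterns (λ w₁ w₂ w₃ → ⟦ region 4 w₁ w₂ w₃ ⟧) (λ w₁ w₂ w₃ → ⟦ (w₃ <ᵇ 2) ∧ not (w₁ <ᵇ 1) ⟧) refl refl refl refl refl refl refl refl

  -- The other cumulative counts are thresholds on a single term.
  cumulative₁ : sumTo 1 N ≡ below 3 1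
  cumulative₁ = trans (N-cumulative 1) (#-by-patterns (in-first 1) (λ _ _ w₃ → ⟦ w₃ <ᵇ 1 ⟧) refl refl refl refl refl refl refl refl)

  cumulative₂ : sumTo 2 N ≡ below 2 1
  cumulative₂ = trans (N-cumulative 2) (#-by-patterns (in-first 2) (λ _ w₂ _ → ⟦ w₂ <ᵇ 1 ⟧) refl refl refl refl refl refl refl refl)

  cumulative₄ : sumTo 4 N ≡ below 1 1
  cumulative₄ = trans (N-cumulative 4) (#-by-patterns (in-first 4) (λ w₁ _ _ → ⟦ w₁ <ᵇ 1 ⟧) refl refl refl refl refl refl refl refl)

  cumulative₆ : sumTo 6 N ≡ below 2 2
  cumulative₆ = trans (N-cumulative 6) (#-by-patterns (in-first 6) (λ _ w₂ _ → ⟦ w₂ <ᵇ 2 ⟧) refl refl refl refl refl refl refl refl)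

  cumulative₇ : sumTo 7 N ≡ below 3 3
  cumulative₇ = trans (N-cumulative 7) (#-by-patterns (in-first 7) (λ _ _ w₃ → ⟦ w₃ <ᵇ 3 ⟧) refl refl refl refl refl refl refl refl)

  cumulative₈ : sumTo 8 N ≡ t * t
  cumulative₈ = trans (N-cumulative 8) (trans (#-by-patterns (in-first 8) (λ _ _ _ → 1) refl refl refl refl refl refl refl refl)
    (trans (sumTo-cong t (λ _ _ → trans (sumTo-const t 1) (*-identityʳ t))) (sumTo-const t t)))

  t² : ℕ
  t² = t * t

  record Size (x p K : ℕ) : Set where
    constructor size
    field approx : 12 * x ≈[ K * t ] p * t²
  open Size public

  Size-weaken : ∀ {x p K K′} → K ≤ K′ → Size x p K → Size x p K′
  Size-weaken K≤K′ (size h) = size (≈-weaken (*-monoˡ-≤ t K≤K′) h)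

  Size-+ : ∀ {x y p q K₁ K₂} → Size x p K₁ → Size y q K₂ → Size (x + y) (p + q) (K₁ + K₂)
  Size-+ {x} {y} {p} {q} {K₁} {K₂} (size hx) (size hy) =
    size (≈-congˡ (sym (*-distribˡ-+ 12 x y)) (≈-congʳ (sym (*-distribʳ-+ t² p q))
      (≈-weaken (≤-reflexive (sym (*-distribʳ-+ t K₁ K₂))) (≈-+ hx hy))))

  Size-∸ : ∀ {x y z p q K₁ K₂} → x + y ≡ z → Size y q K₁ → Size z (p + q) K₂ → Size x p (K₂ + K₁)
  Size-∸ {x} {y} {z} {p} {q} {K₁} {K₂} x+y≡z (size hy) (size hz) =
    size (≈-cancelʳ (≈-weaken (≤-reflexive (sym (*-distribʳ-+ t K₂ K₁)))
      (≈-trans (≈-congˡ (trans (cong (12 *_) (sym x+y≡z)) (*-distribˡ-+ 12 x y)) (≈-congʳ (*-distribʳ-+ t² p q) hz))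
               (≈-+ (≈-reflexive 0 refl) (≈-sym hy)))))

  Size-*ʳ : ∀ {x p K} c → Size x p K → Size (x * c) (p * c) (K * c)
  Size-*ʳ {x} {p} {K} c (size h) =
    size (≈-congˡ (swap-in x c) (≈-congʳ (swap p c t²) (≈-weaken (≤-reflexive (swap K c t)) (≈-*ˡ c h))))
    where
    swap-in : ∀ x c → c * (12 * x) ≡ 12 * (x * c)
    swap-in = solve-∀
    swap : ∀ a c b → c * (a * b) ≡ a * c * b
    swap = solve-∀

  Size-sumTo : ∀ m {x p K : ℕ → ℕ} → (∀ i → i < m → Size (x i) (p i) (K i)) → Size (sumTo m x) (sumTo m p) (sumTo m K)
  Size-sumTo zero    h = size (≈-reflexive 0 refl)
  Size-sumTo (suc m) h = Size-+ (h 0 z<s) (Size-sumTo m (λ i i<m → h (suc i) (s<s i<m)))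

  -- 12 P k (m t) ≈ (6 m² / k) t² and 12 Q k (m t) ≈ (6 (k − m)² / k) t², for m ≤ k and c = 6 / k.
  P-scaled : ∀ k m c → c * (2 * k) ≡ 12 → m ≤ k → Size (P k (m * t) t) (c * (m * m)) (c * (k * k))
  P-scaled k m c c2k≡12 m≤k =
    size (≈-congˡ lhs (≈-congʳ (rhs c m t) (≈-weaken (≤-reflexive (error c t k)) (≈-*ˡ c (P-approx k (m * t) t)))))
    where
    rearrange : ∀ c k p → c * (2 * k * p + 0) ≡ c * (2 * k) * p
    rearrange = solve-∀
    rhs : ∀ c m t → c * ((m * t) * (m * t)) ≡ c * (m * m) * (t * t)
    rhs = solve-∀
    error : ∀ c t k → c * (t * (k * k)) ≡ c * (k * k) * t
    error = solve-∀
    lhs : c * (2 * k * P k (m * t) t + sq (m * t ∸ k * t)) ≡ 12 * P k (m * t) t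
    lhs rewrite m≤n⇒m∸n≡0 (*-monoˡ-≤ t m≤k) = trans (rearrange c k _) (cong (_* P k (m * t) t) c2k≡12)

  Q-scaled : ∀ k m c → c * (2 * k) ≡ 12 → Size (Q k (m * t) t) (c * ((k ∸ m) * (k ∸ m))) (c * (k * k))
  Q-scaled k m c c2k≡12 =
    size (≈-congˡ lhs (≈-congʳ rhs (≈-weaken (≤-reflexive (error c t k)) (≈-*ˡ c (Q-approx k (m * t) t)))))
    where
    rearrange : ∀ c k q → c * (2 * k * q) ≡ c * (2 * k) * q
    rearrange = solve-∀
    square : ∀ c d t → c * ((d * t) * (d * t)) ≡ c * (d * d) * (t * t)
    square = solve-∀
    error : ∀ c t k → c * (t * (k * k)) ≡ c * (k * k) * t
    error = solve-∀
    lhs : c * (2 * k * Q k (m * t) t) ≡ 12 * Q k (m * t) t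
    lhs = trans (rearrange c k _) (cong (_* Q k (m * t) t) c2k≡12)
    rhs : c * sq (k * t ∸ m * t) ≡ c * ((k ∸ m) * (k ∸ m)) * t²
    rhs = trans (cong (λ z → c * sq z) (sym (*-distribʳ-∸ t k m))) (square c (k ∸ m) t)

  below₃₁ : Size (below 3 1) 2 18
  below₃₁ rewrite below-first 3 = P-scaled 3 1 2 refl (s≤s z≤n)

  below₂₁ : Size (below 2 1) 3 12
  below₂₁ rewrite below-first 2 = P-scaled 2 1 3 refl (s≤s z≤n)

  below₁₁ : Size (below 1 1) 6 6
  below₁₁ rewrite below-first 1 = P-scaled 1 1 6 refl (s≤s z≤n)

  below₂₂ : Size (below 2 2) 9 24
  below₂₂ = Size-∸ (below-next 2 1) (P-scaled 2 1 3 refl (s≤s z≤n)) (P-scaled 2 2 3 refl ≤-refl)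

  below₃₃ : Size (below 3 3) 10 36
  below₃₃ = Size-∸ (below-next 3 2) (P-scaled 3 2 2 refl (s≤s (s≤s z≤n))) (P-scaled 3 3 2 refl ≤-refl)

  N₃-size : Size (N 3) 1 30
  N₃-size = Size-∸ N₃-wedge (Q-scaled 3 2 2 refl) (Q-scaled 2 1 3 refl)

  N₄-size : Size (N 4) 1 30
  N₄-size = Size-∸ N₄-wedge (P-scaled 3 1 2 refl (s≤s z≤n)) (P-scaled 2 1 3 refl (s≤s z≤n))

  first₀ : Size (sumTo 0 N) 0 0
  first₀ = size (≈-reflexive 0 refl)

  first₁ : Size (sumTo 1 N) 2 18
  first₁ rewrite cumulative₁ = below₃₁

  first₂ : Size (sumTo 2 N) 3 12
  first₂ rewrite cumulative₂ = below₂₁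

  first₄ : Size (sumTo 4 N) 6 6
  first₄ rewrite cumulative₄ = below₁₁

  first₃ : Size (sumTo 3 N) 5 36
  first₃ = Size-∸ (sym (sumTo-last 3 N)) N₃-size first₄

  first₅ : Size (sumTo 5 N) 7 36
  first₅ rewrite sumTo-last 4 N = Size-+ first₄ N₄-size

  first₆ : Size (sumTo 6 N) 9 24
  first₆ rewrite cumulative₆ = below₂₂

  first₇ : Size (sumTo 7 N) 10 36
  first₇ rewrite cumulative₇ = below₃₃

  first₈ : Size (sumTo 8 N) 12 0
  first₈ = size (≈-reflexive 0 (cong (12 *_) cumulative₈))

  region-from : ∀ j {p q K₁ K₂} → Size (sumTo j N) q K₁ → Size (sumTo (suc j) N) (p + q) K₂ → Size (N j) p (K₂ + K₁)
  region-from j = Size-∸ (trans (+-comm (N j) (sumTo j N)) (sym (sumTo-last j N)))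

  region-size : ∀ i → i < 8 → Size (N i) (weight i) 60
  region-size 0 _ = Size-weaken (≤ᵇ⇒≤ 18 60 tt) (region-from 0 first₀ first₁)
  region-size 1 _ = Size-weaken (≤ᵇ⇒≤ 30 60 tt) (region-from 1 first₁ first₂)
  region-size 2 _ = Size-weaken (≤ᵇ⇒≤ 48 60 tt) (region-from 2 first₂ first₃)
  region-size 3 _ = Size-weaken (≤ᵇ⇒≤ 30 60 tt) N₃-size
  region-size 4 _ = Size-weaken (≤ᵇ⇒≤ 30 60 tt) N₄-size
  region-size 5 _ = Size-weaken (≤ᵇ⇒≤ 60 60 tt) (region-from 5 first₅ first₆)
  region-size 6 _ = Size-weaken (≤ᵇ⇒≤ 60 60 tt) (region-from 6 first₆ first₇)
  region-size 7 _ = Size-weaken (≤ᵇ⇒≤ 36 60 tt) (region-from 7 first₇ first₈)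
  region-size (suc (suc (suc (suc (suc (suc (suc (suc _)))))))) (s<s (s<s (s<s (s<s (s<s (s<s (s<s (s<s ()))))))))

  -- Residues s with 3 ≤ s and s + 4 ≤ t: a progression term there stays away from the
  -- r extra positions after reduction mod n.  All but six residues are central.
  central : ℕ → Bool
  central s = not (s <ᵇ 3) ∧ (s <ᵇ t ∸ 3)

  central-bounds : ∀ s → central s ≡ true → 3 ≤ s × s + 4 ≤ t
  central-bounds s h with s <ᵇ 3 in e₁ | s <ᵇ t ∸ 3 in e₂
  ... | false | true  = ≮⇒≥ (λ s<3 → subst T e₁ (<⇒<ᵇ s<3)) , room (<ᵇ⇒< s (t ∸ 3) (subst T (sym e₂) tt))
    where
    room : s < t ∸ 3 → s + 4 ≤ t
    room s<t∸3 with 3 ≤? t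
    ... | yes 3≤t = subst (_≤ t) (sym (+-suc s 3)) (m≤o∸n⇒m+n≤o (suc s) 3≤t s<t∸3)
    ... | no 3≰t with () ← subst (s <_) (m≤n⇒m∸n≡0 (<⇒≤ (≰⇒> 3≰t))) s<t∸3
  ... | true  | _     with () ← h
  ... | false | false with () ← h

  non-central-count : sumTo t (λ s → ⟦ not (central s) ⟧) ≤ 6
  non-central-count = begin
    sumTo t (λ s → ⟦ not (central s) ⟧)
      ≤⟨ sumTo-mono t (λ s s<t → split s s<t) ⟩
    sumTo t (λ s → ⟦ s <ᵇ 3 ⟧ + ⟦ (s <ᵇ t) ∧ not (s <ᵇ t ∸ 3) ⟧)
      ≡⟨ sumTo-+ t _ _ ⟩
    sumTo t (λ s → ⟦ s <ᵇ 3 ⟧) + sumTo t (λ s → ⟦ (s <ᵇ t) ∧ not (s <ᵇ t ∸ 3) ⟧)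
      ≡⟨ cong₂ _+_ (count-below t 3) (count-between t t (t ∸ 3)) ⟩
    3 ⊓ t + (t ⊓ t ∸ (t ∸ 3))
      ≤⟨ +-mono-≤ (m⊓n≤m 3 t) (≤-trans (∸-monoˡ-≤ (t ∸ 3) (m⊓n≤m t t))
                                      (m≤n+o⇒m∸n≤o t (t ∸ 3) (subst (t ≤_) (+-comm 3 (t ∸ 3)) (m≤n+m∸n t 3)))) ⟩
    3 + 3 ∎
    where
    open ≤-Reasoning
    bound : ∀ a b → ⟦ not (not a ∧ b) ⟧ ≤ ⟦ a ⟧ + ⟦ true ∧ not b ⟧
    bound true  _     = s≤s z≤n
    bound false true  = z≤n
    bound false false = ≤-refl
    split : ∀ s → s < t → ⟦ not (central s) ⟧ ≤ ⟦ s <ᵇ 3 ⟧ + ⟦ (s <ᵇ t) ∧ not (s <ᵇ t ∸ 3) ⟧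
    split s s<t with s <ᵇ t | <⇒<ᵇ s<t
    ... | true | _ = bound (s <ᵇ 3) (s <ᵇ t ∸ 3)

  non-central-column : ∀ c → sumTo t (λ α → ⟦ not (central ((α + c) % t)) ⟧) ≤ 6
  non-central-column c = subst (_≤ 6) (sym (sumTo-rotate t c (λ s → ⟦ not (central s) ⟧))) non-central-count

module GeneralizedAPs (b : ℕ) .{{_ : NonZero b}} (B : Fin b → Bool) (r : ℕ) where
  open ℤ using (+_)

  colourB : ℕ → ℕ → Bool
  colourB e R = B (zmod b (+ e ℤ.- + R))

  shifted-mono : ℕ → ℕ → ℕ → ℕ → ℕ → Bool
  shifted-mono a₀ d₀ w₁ w₂ w₃ = same4 (B (zmod b (+ a₀))) (colourB (a₀ + d₀) (w₁ * r))
                                      (colourB (a₀ + 2 * d₀) (w₂ * r)) (colourB (a₀ + 3 * d₀) (w₃ * r))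

  cᵢ : ℕ → ℕ
  cᵢ i = cI b B r (bit₁ i) (bit₂ i) (bit₃ i)

  cI-sum : ∀ x₁ x₂ x₃ → cI b B r x₁ x₂ x₃ ≡ Σ² b (λ a₀ d₀ → ⟦ shifted-mono a₀ d₀ x₁ (x₁ + x₂) (x₁ + x₂ + x₃) ⟧)
  cI-sum x₁ x₂ x₃ =
    trans (countPairs-sumTo b (λ a d → same4 (B (zmod b (+ a))) (colourB (a + d) (x₁ * r))
                                             (colourB (a + 2 * d) (x₁ * r + x₂ * r)) (colourB (a + 3 * d) (x₁ * r + x₂ * r + x₃ * r))))
          (Σ²-cong b (λ a₀ d₀ _ _ → cong₂ (λ R₂ R₃ → ⟦ same4 (B (zmod b (+ a₀))) (colourB (a₀ + d₀) (x₁ * r))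
                                                              (colourB (a₀ + 2 * d₀) R₂) (colourB (a₀ + 3 * d₀) R₃) ⟧)
                                          (sym (*-distribʳ-+ r x₁ x₂)) cumulative₃))
    where
    cumulative₃ : x₁ * r + x₂ * r + x₃ * r ≡ (x₁ + x₂ + x₃) * r
    cumulative₃ = sym (trans (*-distribʳ-+ r (x₁ + x₂) x₃) (cong (_+ x₃ * r) (*-distribʳ-+ r x₁ x₂)))

  weights-S12 : sumTo 8 (λ i → weight i * cᵢ i) ≡ S12 b B r
  weights-S12 = regroup (cᵢ 0) (cᵢ 1) (cᵢ 2) (cᵢ 3) (cᵢ 4) (cᵢ 5) (cᵢ 6) (cᵢ 7)
    where
    regroup : ∀ a₀ a₁ a₂ a₃ a₄ a₅ a₆ a₇ →
      2 * a₀ + (1 * a₁ + (2 * a₂ + (1 * a₃ + (1 * a₄ + (2 * a₅ + (1 * a₆ + (2 * a₇ + 0)))))))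
      ≡ 2 * a₀ + 1 * a₁ + 2 * a₂ + 1 * a₃ + 1 * a₄ + 2 * a₅ + 1 * a₆ + 2 * a₇
    regroup = solve-∀

  -- The error constant of the theorem: borders, non-central terms, and the eight region counts.
  error-constant : ℕ
  error-constant = 12 * (2 * b * r + r * r + b * (b * 18)) + sumTo 8 (λ i → 60 * cᵢ i)

module Repeating (b : ℕ) .{{_ : NonZero b}} (B : Fin b → Bool) (r : ℕ) (r<b : r < b)
              (t : ℕ) .{{_ : NonZero t}} (n : ℕ) .{{_ : NonZero n}} (n≡bt+r : n ≡ b * t + r)
              (c : Fin n → Bool) (c-repeats : ∀ j → toℕ j < b * t → c j ≡ B (toℕ j mod b)) where
  open ℤ using (+_)
  open GeneralizedAPs b B r
  open Grid t

  colour : ℕ → Bool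
  colour p = c (zmod n (+ p))

  bt≤n : b * t ≤ n
  bt≤n = subst (b * t ≤_) (sym n≡bt+r) (m≤m+n (b * t) r)

  -- A position b u + e, with u wrapping w = u / t times around the t blocks, lands at
  -- b (u % t) + e − w r in [0, b t), whose colour is B (e − w r).
  colour-wrapped : ∀ u e → u / t * r ≤ b * (u % t) → b * (u % t) + e < b * t → colour (b * u + e) ≡ colourB e (u / t * r)
  colour-wrapped u e R≤bs fits = begin
    colour (b * u + e)                ≡⟨ cong (λ x → c (x mod n)) (trans (cong (_% n) position) ([m+kn]%n≡m%n L w n)) ⟩
    c (zmod n (+ L))                  ≡⟨ c-repeats _ (subst (_< b * t) (sym toℕ-L) L<bt) ⟩
    B (toℕ (zmod n (+ L)) mod b)      ≡⟨ cong (λ x → B (x mod b)) toℕ-L ⟩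
    B (L mod b)                       ≡⟨ cong B (mod-from-ℤ b L s (+ e ℤ.- + R) in-ℤ) ⟩
    colourB e R                       ∎
    where
    open ≡-Reasoning
    s w R L : ℕ
    s = u % t
    w = u / t
    R = w * r
    L = (b * s + e) ∸ R
    L+R : L + R ≡ b * s + e
    L+R = m∸n+n≡m (≤-trans R≤bs (m≤m+n (b * s) e))
    L<bt : L < b * t
    L<bt = ≤-<-trans (m∸n≤m (b * s + e) R) fits
    toℕ-L : toℕ (zmod n (+ L)) ≡ L
    toℕ-L = trans (toℕ-zmod n L) (m<n⇒m%n≡m (<-≤-trans L<bt bt≤n))
    expand : ∀ b s w t e → b * (s + w * t) + e ≡ (b * s + e) + w * (b * t)
    expand = solve-∀
    collect : ∀ L w r bt → L + w * r + w * bt ≡ L + w * (bt + r)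
    collect = solve-∀
    position : b * u + e ≡ L + w * n
    position = begin
      b * u + e                   ≡⟨ cong (λ z → b * z + e) (m≡m%n+[m/n]*n u t) ⟩
      b * (s + w * t) + e         ≡⟨ expand b s w t e ⟩
      (b * s + e) + w * (b * t)   ≡⟨ cong (_+ w * (b * t)) (sym L+R) ⟩
      L + R + w * (b * t)         ≡⟨ collect L w r (b * t) ⟩
      L + w * (b * t + r)         ≡⟨ cong (λ z → L + w * z) (sym n≡bt+r) ⟩
      L + w * n                   ∎
    add-sub : ∀ (x y : ℤ.ℤ) → x ≡ (x ℤ.+ y) ℤ.- y
    add-sub = ℤ-Solver.solve-∀
    reorder : ∀ (p e R : ℤ.ℤ) → (p ℤ.+ e) ℤ.- R ≡ (e ℤ.- R) ℤ.+ p
    reorder = ℤ-Solver.solve-∀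
    in-ℤ : + L ≡ (+ e ℤ.- + R) ℤ.+ + (b * s)
    in-ℤ = begin
      + L                          ≡⟨ add-sub (+ L) (+ R) ⟩
      + (L + R) ℤ.- + R            ≡⟨ cong (λ z → + z ℤ.- + R) L+R ⟩
      (+ (b * s) ℤ.+ + e) ℤ.- + R  ≡⟨ reorder (+ (b * s)) (+ e) (+ R) ⟩
      (+ e ℤ.- + R) ℤ.+ + (b * s)  ∎

  colour-first : ∀ α a₀ → α < t → a₀ < b → colour (b * α + a₀) ≡ B (zmod b (+ a₀))
  colour-first α a₀ α<t a₀<b =
    trans (colour-wrapped α a₀ (subst (λ w → w * r ≤ b * (α % t)) (sym α/t≡0) z≤n) fits)
          (cong (λ w → B (zmod b (+ a₀ ℤ.- + (w * r)))) α/t≡0 ∙ cong (λ z → B (zmod b z)) (ℤₚ.+-identityʳ (+ a₀)))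
    where
    _∙_ = trans
    α/t≡0 : α / t ≡ 0
    α/t≡0 = m<n⇒m/n≡0 α<t
    fits : b * (α % t) + a₀ < b * t
    fits = begin-strict
      b * (α % t) + a₀   ≡⟨ cong (λ z → b * z + a₀) (m<n⇒m%n≡m α<t) ⟩
      b * α + a₀         <⟨ +-monoʳ-< (b * α) a₀<b ⟩
      b * α + b          ≡⟨ sym (trans (*-suc b α) (+-comm b (b * α))) ⟩
      b * suc α          ≤⟨ *-monoʳ-≤ b α<t ⟩
      b * t              ∎
      where open ≤-Reasoning

  colour-term : ∀ k α δ a₀ d₀ → k ≤ 3 → α < t → δ < t → a₀ < b → d₀ < b → central ((α + k * δ) % t) ≡ true →
    colour (b * (α + k * δ) + (a₀ + k * d₀)) ≡ colourB (a₀ + k * d₀) (wraps k α δ * r)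
  colour-term k α δ a₀ d₀ k≤3 α<t δ<t a₀<b d₀<b is-central =
    colour-wrapped u e (≤-trans (*-mono-≤ w≤3 (<⇒≤ r<b)) (≤-trans (*-monoˡ-≤ b 3≤s) (≤-reflexive (*-comm s b)))) fits
    where
    u e s : ℕ
    u = α + k * δ
    e = a₀ + k * d₀
    s = u % t
    3≤s : 3 ≤ s
    3≤s = proj₁ (central-bounds s is-central)
    u<4t : u < 4 * t
    u<4t = +-mono-<-≤ α<t (*-mono-≤ k≤3 (<⇒≤ δ<t))
    w≤3 : u / t ≤ 3
    w≤3 = s≤s⁻¹ (m<n*o⇒m/o<n {n = 4} u<4t)
    e<4b : e < 4 * b
    e<4b = +-mono-<-≤ a₀<b (*-mono-≤ k≤3 (<⇒≤ d₀<b))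
    spread : ∀ b s → b * s + 4 * b ≡ b * (s + 4)
    spread = solve-∀
    fits : b * s + e < b * t
    fits = <-≤-trans (+-monoʳ-< (b * s) e<4b)
                     (≤-trans (≤-reflexive (spread b s)) (*-monoʳ-≤ b (proj₂ (central-bounds s is-central))))

  mono-at : ℕ → ℕ → Bool
  mono-at a d = same4 (colour a) (colour (a + d)) (colour (a + 2 * d)) (colour (a + 3 * d))

  -- The progression through the blocks (α, δ) at offsets (a₀, d₀), and its prediction from the wrap pattern.
  actual ideal : ℕ → ℕ → ℕ → ℕ → ℕ
  actual a₀ d₀ α δ = ⟦ mono-at (b * α + a₀) (b * δ + d₀) ⟧
  ideal  a₀ d₀ α δ = ⟦ shifted-mono a₀ d₀ (wraps 1 α δ) (wraps 2 α δ) (wraps 3 α δ) ⟧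

  defects : ℕ → ℕ → ℕ
  defects α δ = ⟦ not (central ((α + 1 * δ) % t)) ⟧ + ⟦ not (central ((α + 2 * δ) % t)) ⟧
              + ⟦ not (central ((α + 3 * δ) % t)) ⟧

  actual≈ideal : ∀ a₀ d₀ α δ → a₀ < b → d₀ < b → α < t → δ < t → actual a₀ d₀ α δ ≈[ defects α δ ] ideal a₀ d₀ α δ
  actual≈ideal a₀ d₀ α δ a₀<b d₀<b α<t δ<t
    with central ((α + 1 * δ) % t) in c₁ | central ((α + 2 * δ) % t) in c₂ | central ((α + 3 * δ) % t) in c₃
  ... | false | _     | _     = ≈-indicators (⟦⟧≤1 _) (⟦⟧≤1 _) (s≤s z≤n)
  ... | true  | false | _     = ≈-indicators (⟦⟧≤1 _) (⟦⟧≤1 _) (s≤s z≤n)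
  ... | true  | true  | false = ≈-indicators (⟦⟧≤1 _) (⟦⟧≤1 _) (s≤s z≤n)
  ... | true  | true  | true  = ≈-reflexive 0 (cong ⟦_⟧ (cong₄ same4
        (colour-first α a₀ α<t a₀<b)
        (trans (cong colour (spread₁ b α a₀ δ d₀))
               (trans (colour-term 1 α δ a₀ d₀ (s≤s z≤n) α<t δ<t a₀<b d₀<b c₁)
                      (cong (λ z → colourB (a₀ + z) (wraps 1 α δ * r)) (*-identityˡ d₀))))
        (trans (cong colour (spread b α a₀ δ d₀ 2)) (colour-term 2 α δ a₀ d₀ (s≤s (s≤s z≤n)) α<t δ<t a₀<b d₀<b c₂))
        (trans (cong colour (spread b α a₀ δ d₀ 3)) (colour-term 3 α δ a₀ d₀ ≤-refl α<t δ<t a₀<b d₀<b c₃))))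
    where
    cong₄ : ∀ {A C : Set} (f : A → A → A → A → C) {x x′ y y′ z z′ v v′} →
            x ≡ x′ → y ≡ y′ → z ≡ z′ → v ≡ v′ → f x y z v ≡ f x′ y′ z′ v′
    cong₄ f refl refl refl refl = refl
    spread : ∀ b α a₀ δ d₀ k → (b * α + a₀) + k * (b * δ + d₀) ≡ b * (α + k * δ) + (a₀ + k * d₀)
    spread = solve-∀
    spread₁ : ∀ b α a₀ δ d₀ → (b * α + a₀) + (b * δ + d₀) ≡ b * (α + 1 * δ) + (a₀ + 1 * d₀)
    spread₁ = solve-∀

  defects-total : Σ² t (λ δ α → defects α δ) ≤ t * 18
  defects-total = ≤-trans (sumTo-mono t (λ δ _ → column δ)) (≤-reflexive (sumTo-const t 18))
    where
    column : ∀ δ → sumTo t (λ α → defects α δ) ≤ 18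
    column δ = begin
      sumTo t (λ α → defects α δ)
        ≡⟨ trans (sumTo-+ t _ _) (cong (_+ sumTo t (λ α → ⟦ not (central ((α + 3 * δ) % t)) ⟧)) (sumTo-+ t _ _)) ⟩
      sumTo t (λ α → ⟦ not (central ((α + 1 * δ) % t)) ⟧) + sumTo t (λ α → ⟦ not (central ((α + 2 * δ) % t)) ⟧)
        + sumTo t (λ α → ⟦ not (central ((α + 3 * δ) % t)) ⟧)
        ≤⟨ +-mono-≤ (+-mono-≤ (non-central-column (1 * δ)) (non-central-column (2 * δ))) (non-central-column (3 * δ)) ⟩
      18 ∎
      where open ≤-Reasoning

  pattern-value : ℕ → ℕ → ℕ → ℕ
  pattern-value a₀ d₀ i = ⟦ shifted-mono a₀ d₀ (bit₁ i) (bit₁ i + bit₂ i) (bit₁ i + bit₂ i + bit₃ i) ⟧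

  ideal-by-pattern : ∀ a₀ d₀ α δ → α < t → δ < t →
    ideal a₀ d₀ α δ ≡ sumTo 8 (λ i → ⟦ region i (wraps 1 α δ) (wraps 2 α δ) (wraps 3 α δ) ⟧ * pattern-value a₀ d₀ i)
  ideal-by-pattern a₀ d₀ =
    at-every-point (λ w₁ w₂ w₃ → ⟦ shifted-mono a₀ d₀ w₁ w₂ w₃ ⟧ ≡ sumTo 8 (λ i → ⟦ region i w₁ w₂ w₃ ⟧ * pattern-value a₀ d₀ i))
      (pad _) (pad _) (pad _) (pad _) (pad _) (pad _) (pad _) (pad _)
    where
    -- exactly one region contains the point, and contributes 1 * value
    pad : ∀ x → x ≡ x + 0 + 0
    pad x = sym (trans (+-identityʳ (x + 0)) (+-identityʳ x))

  ideal-total : Σ² b (λ a₀ d₀ → Σ² t (λ δ α → ideal a₀ d₀ α δ)) ≡ sumTo 8 (λ i → N i * cᵢ i)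
  ideal-total = begin
    Σ² b (λ a₀ d₀ → Σ² t (λ δ α → ideal a₀ d₀ α δ))
      ≡⟨ Σ²-cong b (λ a₀ d₀ _ _ → per-offset a₀ d₀) ⟩
    Σ² b (λ a₀ d₀ → sumTo 8 (λ i → N i * pattern-value a₀ d₀ i))
      ≡⟨ Σ²-sumTo b 8 (λ i a₀ d₀ → N i * pattern-value a₀ d₀ i) ⟩
    sumTo 8 (λ i → Σ² b (λ a₀ d₀ → N i * pattern-value a₀ d₀ i))
      ≡⟨ sumTo-cong 8 (λ i _ → trans (Σ²-*ˡ b (N i) _) (cong (N i *_) (sym (cI-sum (bit₁ i) (bit₂ i) (bit₃ i))))) ⟩
    sumTo 8 (λ i → N i * cᵢ i) ∎
    where
    open ≡-Reasoning
    per-offset : ∀ a₀ d₀ → Σ² t (λ δ α → ideal a₀ d₀ α δ) ≡ sumTo 8 (λ i → N i * pattern-value a₀ d₀ i)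
    per-offset a₀ d₀ =
      trans (Σ²-cong t (λ δ α δ<t α<t → ideal-by-pattern a₀ d₀ α δ α<t δ<t))
            (trans (Σ²-sumTo t 8 (λ i δ α → ⟦ region i (wraps 1 α δ) (wraps 2 α δ) (wraps 3 α δ) ⟧ * pattern-value a₀ d₀ i))
                   (sumTo-cong 8 (λ i _ → Σ²-*ʳ t (pattern-value a₀ d₀ i) (λ δ α → ⟦ region i (wraps 1 α δ) (wraps 2 α δ) (wraps 3 α δ) ⟧))))

  mono4≈regions : mono4 n c ≈[ b * t * r + r * (b * t + r) + b * (b * (t * 18)) ] sumTo 8 (λ i → N i * cᵢ i)
  mono4≈regions =
    ≈-congˡ (sym (countPairs-sumTo n mono-at))
      (≈-trans border (≈-congˡ (sym (Σ²-blocks b t (λ a d → ⟦ mono-at a d ⟧))) (≈-congʳ ideal-total grid)))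
    where
    border : Σ² n (λ a d → ⟦ mono-at a d ⟧) ≈[ b * t * r + r * (b * t + r) ] Σ² (b * t) (λ a d → ⟦ mono-at a d ⟧)
    border = subst (λ m → Σ² m (λ a d → ⟦ mono-at a d ⟧) ≈[ b * t * r + r * (b * t + r) ] Σ² (b * t) (λ a d → ⟦ mono-at a d ⟧))
                   (sym n≡bt+r) (Σ²-border (b * t) r _ (λ a d → ⟦⟧≤1 (mono-at a d)))
    grid : Σ² b (λ a₀ d₀ → Σ² t (λ δ α → actual a₀ d₀ α δ)) ≈[ b * (b * (t * 18)) ] Σ² b (λ a₀ d₀ → Σ² t (λ δ α → ideal a₀ d₀ α δ))
    grid = ≈-weaken (≤-reflexive (Σ²-const b (t * 18)))
             (≈-Σ² b (λ a₀ d₀ a₀<b d₀<b → ≈-weaken defects-total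
               (≈-Σ² t (λ δ α δ<t α<t → actual≈ideal a₀ d₀ α δ a₀<b d₀<b α<t δ<t))))

  regions-size : Size (sumTo 8 (λ i → N i * cᵢ i)) (S12 b B r) (sumTo 8 (λ i → 60 * cᵢ i))
  regions-size = subst (λ p → Size (sumTo 8 (λ i → N i * cᵢ i)) p (sumTo 8 (λ i → 60 * cᵢ i))) weights-S12
                       (Size-sumTo 8 (λ i i<8 → Size-*ʳ (cᵢ i) (region-size i i<8)))

  mono4-approx : 12 * mono4 n c ≈[ error-constant * t ] S12 b B r * t²
  mono4-approx = ≈-weaken bound (≈-trans (≈-*ˡ 12 mono4≈regions) (approx regions-size))
    where
    S = sumTo 8 (λ i → 60 * cᵢ i)
    gather : ∀ b t r S → 12 * (b * t * r + r * (b * t + r) + b * (b * (t * 18))) + S * t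
                         ≡ 12 * ((2 * b * r + b * (b * 18)) * t + r * r) + S * t
    gather = solve-∀
    scatter : ∀ b t r S → 12 * ((2 * b * r + b * (b * 18)) * t + r * r * t) + S * t
                          ≡ (12 * (2 * b * r + r * r + b * (b * 18)) + S) * t
    scatter = solve-∀
    bound : 12 * (b * t * r + r * (b * t + r) + b * (b * (t * 18))) + S * t ≤ error-constant * t
    bound = begin
      12 * (b * t * r + r * (b * t + r) + b * (b * (t * 18))) + S * t   ≡⟨ gather b t r S ⟩
      12 * ((2 * b * r + b * (b * 18)) * t + r * r) + S * t             ≤⟨ +-monoˡ-≤ (S * t) (*-monoʳ-≤ 12 (+-monoʳ-≤ ((2 * b * r + b * (b * 18)) * t) (m≤m*n (r * r) t))) ⟩
      12 * ((2 * b * r + b * (b * 18)) * t + r * r * t) + S * t         ≡⟨ scatter b t r S ⟩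
      error-constant * t                                                 ∎
      where open ≤-Reasoning

-- The statement's +_ from Data.Integer would make ℕ sections (x +_) ambiguous, so it is imported last.
open import Data.Integer using (+_; _-_; ∣_∣)

∣-∣≤ : ∀ {x y e} → x ≈[ e ] y → ∣ + x - + y ∣ ≤ e
∣-∣≤ {x} {y} {e} (x≤y+e , y≤x+e) with x ≤? y
... | yes x≤y = subst (_≤ e) (sym (trans (cong ∣_∣ (ℤₚ.m-n≡m⊖n x y)) (ℤₚ.∣⊖∣-≤ x≤y))) (m≤n+o⇒m∸n≤o y x y≤x+e)
... | no x≰y  = subst (_≤ e) (sym (trans (cong ∣_∣ (ℤₚ.m-n≡m⊖n x y)) (trans (ℤₚ.∣m⊖n∣≡∣n⊖m∣ x y) (ℤₚ.∣⊖∣-≤ (<⇒≤ (≰⇒> x≰y))))))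
                      (m≤n+o⇒m∸n≤o x y x≤y+e)

density-bound : ∀ k b .{{_ : NonZero b}} S M K t n → 12 * M ≤ S * (t * t) + K * t → k * K ≤ t → b * t ≤ n →
  k * (12 * (b * b)) * M ≤ (k * S + 12 * (b * b)) * (n * n)
density-bound k b S M K t n 12M≤ kK≤t bt≤n = begin
  k * (12 * (b * b)) * M                                 ≡⟨ e₁ k b M ⟩
  (k * (b * b)) * (12 * M)                               ≤⟨ *-monoʳ-≤ (k * (b * b)) 12M≤ ⟩
  (k * (b * b)) * (S * (t * t) + K * t)                  ≡⟨ e₂ k b S t K ⟩
  k * S * ((b * t) * (b * t)) + (b * b) * ((k * K) * t)  ≤⟨ +-mono-≤ (*-monoʳ-≤ (k * S) (*-mono-≤ bt≤n bt≤n))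
                                                                      (*-monoʳ-≤ (b * b) (*-mono-≤ (≤-trans kK≤t t≤n) t≤n)) ⟩
  k * S * (n * n) + (b * b) * (n * n)                    ≤⟨ m≤m+n _ (11 * ((b * b) * (n * n))) ⟩
  k * S * (n * n) + (b * b) * (n * n) + 11 * ((b * b) * (n * n)) ≡⟨ e₃ k S b n ⟩
  (k * S + 12 * (b * b)) * (n * n)                       ∎
  where
  open ≤-Reasoning
  t≤n : t ≤ n
  t≤n = ≤-trans (m≤n*m t b) bt≤n
  e₁ : ∀ k b M → k * (12 * (b * b)) * M ≡ (k * (b * b)) * (12 * M)
  e₁ = solve-∀
  e₂ : ∀ k b S t K → (k * (b * b)) * (S * (t * t) + K * t) ≡ k * S * ((b * t) * (b * t)) + (b * b) * ((k * K) * t)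
  e₂ = solve-∀
  e₃ : ∀ k S b n → k * S * (n * n) + (b * b) * (n * n) + 11 * ((b * b) * (n * n)) ≡ (k * S + 12 * (b * b)) * (n * n)
  e₃ = solve-∀

lemma4 : (b : ℕ) .{{_ : NonZero b}} (B : Fin b → Bool) (r : ℕ) → 1 ≤ r → r < b →
    (Σ ℕ λ K → Σ ℕ λ T →
       (t n : ℕ) .{{_ : NonZero n}} → 1 ≤ t → T ≤ t → n ≡ b * t + r →
       (c : Fin n → Bool) → (∀ (j : Fin n) → toℕ j < b * t → c j ≡ B (toℕ j mod b)) →
       ∣ + (12 * mono4 n c) - + (S12 b B r * (t * t)) ∣ ≤ K * t)
    ×
    ((k : ℕ) → 1 ≤ k → Σ ℕ λ T →
       (t n : ℕ) .{{_ : NonZero n}} → 1 ≤ t → T ≤ t → n ≡ b * t + r →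
       Σ (Fin n → Bool) λ c →
         k * (12 * (b * b)) * mono4 n c ≤ (k * S12 b B r + 12 * (b * b)) * (n * n))
lemma4 b B r _ r<b =
  (error-constant , 0 , λ { t@(suc _) n _ _ n≡bt+r c c-repeats →
      ∣-∣≤ (Repeating.mono4-approx b B r r<b t n n≡bt+r c c-repeats) }) ,
  -- the density, for c repeating B everywhere, once t ≥ k K
  λ k _ → k * error-constant , λ { t@(suc _) n _ kK≤t n≡bt+r →
      repeat n , density-bound k b (S12 b B r) (mono4 n (repeat n)) error-constant t n
                   (proj₁ (Repeating.mono4-approx b B r r<b t n n≡bt+r (repeat n) (λ _ _ → refl)))
                   kK≤t (Repeating.bt≤n b B r r<b t n n≡bt+r (repeat n) (λ _ _ → refl)) }
  where
  open GeneralizedAPs b B r using (error-constant)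
  repeat : ∀ n → Fin n → Bool
  repeat n j = B (toℕ j mod b)
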